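{- Let $L$ be a dcpo-$\vee_{\uparrow}$-semilattice and $A \subseteq L$. Then $A$ is $F$-$\bigvee$-existing if and only if $cl_{F}(A)$ is $F$-$\bigvee$-existing.
   Context: A subset of a poset is consistent if it has an upper bound. A dcpo-$\vee_{\uparrow}$-semilattice is a dcpo in which every consistent pair of elements has a join. A dcpo-$\vee_{\uparrow}$-semilattice homomorphism is a Scott continuous map preserving joins of consistent pairs. A subset $A$ of $L$ is $F$-Scott closed if it is a lower set closed under directed suprema and $\bigvee F \in A$ for every nonempty finite consistent $F \subseteq A$; $cl_F(A)$ is the smallest $F$-Scott closed set containing $A$. A subset $A \subseteq L$ is $F$-$\bigvee$-existing if for every dcpo-$\vee_{\uparrow}$-semilattice homomorphism $f : L \to M$ into any dcpo-$\vee_{\uparrow}$-semilattice $M$, $\bigvee f(A)$ exists in $M$. -}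

module Defs where

open import Level using (Level; _⊔_) renaming (suc to lsuc)
open import Data.Product using (Σ; ∃; _×_; _,_; proj₁)
open import Data.List using (List; [])
open import Data.List.Membership.Propositional using (_∈_)
open import Relation.Binary.PropositionalEquality using (_≡_)
open import Relation.Unary using (Pred; _⊆_)
open import Relation.Nullary using (¬_)

IsLubFam : ∀ {a c r p} {I : Set a} {C : Set c} (_≤_ : C → C → Set r)
           (P : Pred I p) (g : I → C) (s : C) → Set (a ⊔ c ⊔ r ⊔ p)
IsLubFam _≤_ P g s =
  (∀ x → P x → g x ≤ s) × (∀ u → (∀ x → P x → g x ≤ u) → s ≤ u)

Directed : ∀ {c r p} {C : Set c} (_≤_ : C → C → Set r) (D : Pred C p) → Set (c ⊔ r ⊔ p)
Directed {C = C} _≤_ D =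
  (∃ λ x → D x) ×
  (∀ x y → D x → D y → Σ C λ z → D z × x ≤ z × y ≤ z)

Consistent : ∀ {c r} {C : Set c} (_≤_ : C → C → Set r) → C → C → Set (c ⊔ r)
Consistent {C = C} _≤_ x y = Σ C λ u → x ≤ u × y ≤ u

IsJoin : ∀ {c r} {C : Set c} (_≤_ : C → C → Set r) → C → C → C → Set (c ⊔ r)
IsJoin _≤_ x y s = x ≤ s × y ≤ s × (∀ u → x ≤ u → y ≤ u → s ≤ u)

record DcpoSL (o : Level) : Set (lsuc o) where
  field
    Carrier : Set o
    _≤_     : Carrier → Carrier → Set o
    ≤-refl  : ∀ {x} → x ≤ x
    ≤-trans : ∀ {x y z} → x ≤ y → y ≤ z → x ≤ z
    ≤-antisym : ∀ {x y} → x ≤ y → y ≤ x → x ≡ y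
    dsup    : (D : Pred Carrier o) → Directed _≤_ D →
              Σ Carrier (IsLubFam _≤_ D (λ x → x))
    join    : ∀ x y → Consistent _≤_ x y → Σ Carrier (IsJoin _≤_ x y)

open DcpoSL

record IsHom {o o'} (L : DcpoSL o) (M : DcpoSL o')
             (f : Carrier L → Carrier M) : Set (lsuc o ⊔ o') where
  field
    scott : ∀ (D : Pred (Carrier L) o) (d : Directed (_≤_ L) D) →
            IsLubFam (_≤_ M) D f (f (proj₁ (dsup L D d)))
    pres-join : ∀ x y (c : Consistent (_≤_ L) x y) →
                IsJoin (_≤_ M) (f x) (f y) (f (proj₁ (join L x y c)))

record FScottClosed {o q} (L : DcpoSL o) (A : Pred (Carrier L) q) : Set (lsuc o ⊔ q) where
  field
    lower   : ∀ {x y} → _≤_ L x y → A y → A x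
    dirSup  : ∀ (D : Pred (Carrier L) o) (d : Directed (_≤_ L) D) →
              D ⊆ A → A (proj₁ (dsup L D d))
    finJoin : ∀ (F : List (Carrier L)) → ¬ (F ≡ []) →
              (∀ x → x ∈ F → A x) →
              (Σ (Carrier L) λ u → ∀ x → x ∈ F → _≤_ L x u) →
              ∀ s → IsLubFam (_≤_ L) (λ x → x ∈ F) (λ x → x) s → A s

-- cl_F(A): the smallest F-Scott closed set containing A, given as the
-- inductive closure of A under the F-Scott closure conditions (lower sets,
-- directed suprema, joins of nonempty finite consistent subsets)
data clF {o q} (L : DcpoSL o) (A : Pred (Carrier L) q) : Pred (Carrier L) (lsuc o ⊔ q) where
  base    : ∀ {x} → A x → clF L A x
  lower   : ∀ {x y} → _≤_ L x y → clF L A y → clF L A x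
  dirSup  : ∀ (D : Pred (Carrier L) o) (d : Directed (_≤_ L) D) →
            (∀ x → D x → clF L A x) → clF L A (proj₁ (dsup L D d))
  finJoin : ∀ (F : List (Carrier L)) → ¬ (F ≡ []) →
            (∀ x → x ∈ F → clF L A x) →
            (Σ (Carrier L) λ u → ∀ x → x ∈ F → _≤_ L x u) →
            ∀ s → IsLubFam (_≤_ L) (λ x → x ∈ F) (λ x → x) s → clF L A s

FVExisting : ∀ {o q} (L : DcpoSL o) (A : Pred (Carrier L) q) (o' : Level) →
             Set (lsuc o ⊔ q ⊔ lsuc o')
FVExisting {o} L A o' =
  (M : DcpoSL o') (f : Carrier L → Carrier M) → IsHom L M f →
  Σ (Carrier M) (IsLubFam (_≤_ M) A f)

-- A homomorphism f is monotone, and it sends every element of cl_F(A) below every upper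
-- bound of f(A): lower sets by monotonicity, directed suprema by Scott continuity, and
-- finite consistent joins because f preserves binary consistent joins, hence (by
-- induction on the list) joins of nonempty bounded finite sets. So f(A) and f(cl_F(A))
-- have the same upper bounds, and one has a least one iff the other does.
module Submission where

open import Defs
open import Level using (Level)
open import Data.Product using (_×_; Σ; _,_; proj₂)
open import Relation.Unary using (Pred; _⊆_)
open import Data.List using (List; []; _∷_)
open import Data.List.Membership.Propositional using (_∈_)
open import Data.List.Relation.Unary.Any using (here; there)
open import Relation.Binary.PropositionalEquality using (_≡_; refl; subst)
open import Relation.Nullary using (¬_)
open import Data.Empty using (⊥-elim)

module _ {a c r p q} {I : Set a} {C : Set c} {_≤_ : C → C → Set r} {g : I → C}
         {P : Pred I p} {Q : Pred I q} (P⊆Q : P ⊆ Q)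
         (same-bounds : ∀ u → (∀ x → P x → g x ≤ u) → ∀ x → Q x → g x ≤ u) where

  lub-extend : ∀ {s} → IsLubFam _≤_ P g s → IsLubFam _≤_ Q g s
  lub-extend (ub , least) = same-bounds _ ub , (λ u k → least u (λ x Px → k x (P⊆Q Px)))

  lub-restrict : ∀ {s} → IsLubFam _≤_ Q g s → IsLubFam _≤_ P g s
  lub-restrict (ub , least) = (λ x Px → ub x (P⊆Q Px)) , (λ u k → least u (same-bounds u k))

lub-unique : ∀ {o i p} (L : DcpoSL o) {I : Set i} {P : Pred I p} {g : I → DcpoSL.Carrier L} {s t} →
             IsLubFam (DcpoSL._≤_ L) P g s → IsLubFam (DcpoSL._≤_ L) P g t → s ≡ t
lub-unique L (ubs , leasts) (ubt , leastt) = DcpoSL.≤-antisym L (leasts _ ubt) (leastt _ ubs)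

module Hom {o o'} {L : DcpoSL o} {M : DcpoSL o'}
           {f : DcpoSL.Carrier L → DcpoSL.Carrier M} (hom : IsHom L M f) where
  open DcpoSL L renaming (Carrier to C; _≤_ to _≤L_; ≤-refl to ≤L-refl; ≤-trans to ≤L-trans)
  open DcpoSL M using () renaming (_≤_ to _≤M_; ≤-trans to ≤M-trans)
  open IsHom hom

  BoundedBy : List C → C → Set o
  BoundedBy F b = ∀ x → x ∈ F → x ≤L b

  monotone : ∀ {x y} → x ≤L y → f x ≤M f y
  monotone {x} {y} x≤y with join x y (y , x≤y , ≤L-refl) | pres-join x y (y , x≤y , ≤L-refl)
  ... | j , _ , y≤j , least | fx≤fj , _ =
    subst (λ z → f x ≤M f z) (≤-antisym (least y x≤y ≤L-refl) y≤j) fx≤fj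

  finite-lub : ∀ x xs {b} → BoundedBy (x ∷ xs) b →
               Σ C λ s → IsLubFam _≤L_ (_∈ x ∷ xs) (λ z → z) s ×
                         (∀ u → (∀ z → z ∈ x ∷ xs → f z ≤M u) → f s ≤M u)
  finite-lub x [] _ =
    x , ((λ { z (here refl) → ≤L-refl }) , (λ u k → k x (here refl))) , (λ u k → k x (here refl))
  finite-lub x (y ∷ ys) {b} bounded
    with finite-lub y ys (λ z z∈ → bounded z (there z∈))
  ... | s , (s-ub , s-least) , fs-least
    with join x s (b , bounded x (here refl) , s-least b (λ z z∈ → bounded z (there z∈)))
       | pres-join x s (b , bounded x (here refl) , s-least b (λ z z∈ → bounded z (there z∈)))
  ... | j , x≤j , s≤j , j-least | _ , _ , fj-least =
    j , (j-ub , λ u k → j-least u (k x (here refl)) (s-least u (λ z z∈ → k z (there z∈))))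
      , (λ u k → fj-least u (k x (here refl)) (fs-least u (λ z z∈ → k z (there z∈))))
    where
    j-ub : ∀ z → z ∈ x ∷ y ∷ ys → z ≤L j
    j-ub z (here refl) = x≤j
    j-ub z (there z∈)  = ≤L-trans (s-ub z z∈) s≤j

  finite-lub-image-least : ∀ F → ¬ F ≡ [] → Σ C (BoundedBy F) →
                           ∀ s → IsLubFam _≤L_ (_∈ F) (λ z → z) s →
                           ∀ u → (∀ x → x ∈ F → f x ≤M u) → f s ≤M u
  finite-lub-image-least [] F≢[] _ = ⊥-elim (F≢[] refl)
  finite-lub-image-least (x ∷ xs) _ (b , bounded) s s-lub
    with finite-lub x xs bounded
  ... | t , t-lub , ft-least = subst (λ z → ∀ u → _ → f z ≤M u) (lub-unique L t-lub s-lub) ft-least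

  closure-bounds : ∀ {q} {A : Pred C q} u → (∀ x → A x → f x ≤M u) →
                   ∀ x → clF L A x → f x ≤M u
  closure-bounds u bounds x (base Ax) = bounds x Ax
  closure-bounds u bounds x (lower x≤y y∈cl) = ≤M-trans (monotone x≤y) (closure-bounds u bounds _ y∈cl)
  closure-bounds u bounds _ (dirSup D d D⊆cl) =
    proj₂ (scott D d) u (λ z z∈D → closure-bounds u bounds z (D⊆cl z z∈D))
  closure-bounds u bounds s (finJoin F F≢[] F⊆cl bounded .s s-lub) =
    finite-lub-image-least F F≢[] bounded s s-lub u (λ z z∈F → closure-bounds u bounds z (F⊆cl z z∈F))

lemma3p6 : ∀ {o q} (L : DcpoSL o) (A : Pred (DcpoSL.Carrier L) q) (o' : Level) →
    (FVExisting L A o' → FVExisting L (clF L A) o') × (FVExisting L (clF L A) o' → FVExisting L A o')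
lemma3p6 L A o' = extend , restrict
  where
  extend : FVExisting L A o' → FVExisting L (clF L A) o'
  extend A-exists M f hom =
    let s , s-lub = A-exists M f hom in s , lub-extend {_≤_ = DcpoSL._≤_ M} base (Hom.closure-bounds hom) s-lub

  restrict : FVExisting L (clF L A) o' → FVExisting L A o'
  restrict cl-exists M f hom =
    let s , s-lub = cl-exists M f hom in s , lub-restrict {_≤_ = DcpoSL._≤_ M} base (Hom.closure-bounds hom) s-lub
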